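{- Let $\ell,k\in\mathbb{N}$, let $H\subseteq[\ell]^k$ be a collection of ordered $k$-tuples, each $\mathbf{a}\in H$ carrying a nonnegative weight $w(\mathbf{a})$, and let $p>0$ be such that $w_H:=\sum_{\mathbf{a}\in H}w(\mathbf{a})\ge p\ell$. For $x\in[\ell]$ and $i\in[k]$ let $w_i(x)=\sum_{\mathbf{a}\in H:\ \mathbf{a}_i=x}w(\mathbf{a})$, where $\mathbf{a}_i$ is the $i$-th coordinate of $\mathbf{a}$. Then for every real $a\ge\sqrt{k}$ there exists $\mathbf{a}\in H$ such that for every $i\in[k]$, $w_i(\mathbf{a}_i)\ge p/a^2$ (i.e. $\mathbf{a}_i$ is $(i,1/a^2)$-heavy).
   Context: For $H$ with $w_H\ge p\ell$, a value $x\in[\ell]$ is called $(i,\beta)$-heavy if $w_i(x)\ge\beta p$.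
   Formalization: The weights $w(\mathbf{a})$ and the number $p$ are rational, and the parameter $a$ ranges over the rationals instead of the reals. -}

module Defs where

open import Data.Nat as ℕ using (ℕ)
open import Data.Fin using (Fin) renaming (_≟_ to _≟ᶠ_)
open import Data.Vec using (Vec; lookup)
open import Data.List using (List; []; _∷_)
open import Data.Rational using (ℚ; 0ℚ; _+_; _*_; _÷_; _≤_; Positive)
open import Data.Rational.Properties using (pos⇒nonZero; pos*pos⇒pos)
open import Relation.Nullary using (yes; no)

-- A k-tuple over [ℓ] = {0,…,ℓ-1} (indices shifted by one w.r.t. the paper).
Tuple : ℕ → ℕ → Set
Tuple ℓ k = Vec (Fin ℓ) k

wH : ∀ {ℓ k} → (Tuple ℓ k → ℚ) → List (Tuple ℓ k) → ℚ
wH w []      = 0ℚ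
wH w (a ∷ H) = w a + wH w H

wᵢ : ∀ {ℓ k} → (Tuple ℓ k → ℚ) → List (Tuple ℓ k) → Fin k → Fin ℓ → ℚ
wᵢ w []      i x = 0ℚ
wᵢ w (a ∷ H) i x with lookup a i ≟ᶠ x
... | yes _ = w a + wᵢ w H i x
... | no  _ = wᵢ w H i x

_/sq_ : ℚ → (a : ℚ) → .{{Positive a}} → ℚ
_/sq_ p a {{pa}} = (p ÷ (a * a)) {{pos⇒nonZero (a * a) {{pos*pos⇒pos a {{pa}} a {{pa}}}}}}

open import Data.Integer using (+_)
open import Data.Rational using (_/_)
ℕtoℚ : ℕ → ℚ
ℕtoℚ n = (+ n) / 1

{-# OPTIONS --safe #-}
-- Suppose no tuple of H is heavy in every coordinate, and let c = p/a². Every tuple then has a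
-- coordinate i whose value x is light, w_i(x) < c, so the weight of H is covered by the
-- k sums Σ_{x light for i} w_i(x). Each is at most ℓ c, and one is strictly smaller because
-- H is nonempty. Hence w_H < k ℓ c ≤ ℓ p ≤ w_H, a contradiction.
module Submission where

open import Defs
open import Algebra.Bundles using (CommutativeMonoid)
open import Data.Nat using (ℕ; NonZero; zero; suc)
import Data.Integer as ℤ
import Data.Integer.Properties as ℤ
open import Data.Nat.Coprimality using (gcd≡1⇒coprime)
open import Data.Nat.GCD using (gcd-zeroʳ)
open import Data.Fin using (Fin; punchIn) renaming (_≟_ to _≟ᶠ_)
open import Data.Fin.Properties using (all?; ¬∀⟶∃¬; punchInᵢ≢i)
open import Data.Vec using (lookup)
open import Data.Vec.Functional using (Vector)
open import Data.List using (List; []; _∷_)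
open import Data.List.Membership.Propositional using (_∈_; find)
open import Data.List.Relation.Unary.All as All using (All; []; _∷_)
open import Data.List.Relation.Unary.All.Properties using (¬Any⇒All¬)
open import Data.List.Relation.Unary.Any using (here; any?)
open import Data.List.Relation.Unary.Unique.Propositional using (Unique)
open import Data.Rational using (ℚ; 0ℚ; 1ℚ; mkℚ; _+_; _*_; 1/_; _≤_; _<_; Positive; NonNegative)
  renaming (NonZero to NonZeroℚ)
open import Data.Rational.Properties
open import Data.Product using (Σ; ∃; _×_; _,_; proj₁; proj₂)
open import Function using (_∘_)
open import Relation.Binary.PropositionalEquality
open import Relation.Nullary using (Dec; yes; no; ¬_; contradiction)
open import Relation.Unary using (Pred; Decidable)

open import Algebra.Properties.CommutativeMonoid.Sum +-0-commutativeMonoid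
  using (sum; sum-remove; sum-cong-≗; sum-replicate-zero; ∑-distrib-+)
open import Algebra.Properties.CommutativeSemigroup
  (CommutativeMonoid.commutativeSemigroup *-1-commutativeMonoid)
  using (x∙yz≈y∙xz)

ℕtoℚ≡mkℚ : ∀ n → ℕtoℚ n ≡ mkℚ (ℤ.+_ n) 0 (gcd≡1⇒coprime (gcd-zeroʳ n))
ℕtoℚ≡mkℚ n = normalize-coprime (gcd≡1⇒coprime (gcd-zeroʳ n))

ℕtoℚ-suc : ∀ n → ℕtoℚ (suc n) ≡ 1ℚ + ℕtoℚ n
ℕtoℚ-suc n rewrite ℕtoℚ≡mkℚ n =
  /-cong {p₁ = ℤ.+_ (suc n)} (cong (ℤ._+_ (ℤ.+_ 1)) (sym (ℤ.*-identityʳ (ℤ.+_ n)))) refl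

sum-const : ∀ n q → sum {n} (λ _ → q) ≡ ℕtoℚ n * q
sum-const zero    q = sym (*-zeroˡ q)
sum-const (suc n) q = begin
  q + sum {n} (λ _ → q)  ≡⟨ cong (q +_) (sum-const n q) ⟩
  q + ℕtoℚ n * q         ≡⟨ cong (_+ ℕtoℚ n * q) (*-identityˡ q) ⟨
  1ℚ * q + ℕtoℚ n * q    ≡⟨ *-distribʳ-+ q 1ℚ (ℕtoℚ n) ⟨
  (1ℚ + ℕtoℚ n) * q      ≡⟨ cong (_* q) (ℕtoℚ-suc n) ⟨
  ℕtoℚ (suc n) * q       ∎
  where open ≡-Reasoning

sum-mono-≤ : ∀ {n} {f g : Vector ℚ n} → (∀ x → f x ≤ g x) → sum f ≤ sum g
sum-mono-≤ {zero}  f≤g = ≤-refl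
sum-mono-≤ {suc n} f≤g = +-mono-≤ (f≤g Fin.zero) (sum-mono-≤ (f≤g ∘ Fin.suc))

sum-mono-< : ∀ {n} {f g : Vector ℚ n} → (∀ x → f x ≤ g x) → ∀ x₀ → f x₀ < g x₀ → sum f < sum g
sum-mono-< f≤g Fin.zero    f₀<g₀ = +-mono-<-≤ f₀<g₀ (sum-mono-≤ (f≤g ∘ Fin.suc))
sum-mono-< f≤g (Fin.suc x) fₓ<gₓ = +-mono-≤-< (f≤g Fin.zero) (sum-mono-< (f≤g ∘ Fin.suc) x fₓ<gₓ)

sum-nonNeg : ∀ {n} {f : Vector ℚ n} → (∀ x → 0ℚ ≤ f x) → 0ℚ ≤ sum f
sum-nonNeg {n} {f} f≥0 = subst (_≤ sum f) (sum-replicate-zero n) (sum-mono-≤ f≥0)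

lookup≤sum : ∀ {n} {f : Vector ℚ n} → (∀ x → 0ℚ ≤ f x) → ∀ i → f i ≤ sum f
lookup≤sum {suc _} {f} f≥0 i = begin
  f i                          ≡⟨ +-identityʳ (f i) ⟨
  f i + 0ℚ                     ≤⟨ +-monoʳ-≤ (f i) (sum-nonNeg (f≥0 ∘ punchIn i)) ⟩
  f i + sum (f ∘ punchIn i)    ≡⟨ sum-remove {i = i} f ⟨
  sum f                        ∎
  where open ≤-Reasoning

sum-vanishing-off : ∀ {n} (f : Vector ℚ n) y → (∀ x → y ≢ x → f x ≡ 0ℚ) → sum f ≡ f y
sum-vanishing-off {suc n} f y f≡0 = begin
  sum f                      ≡⟨ sum-remove {i = y} f ⟩
  f y + sum (f ∘ punchIn y)  ≡⟨ cong (f y +_) (sum-cong-≗ λ x → f≡0 (punchIn y x) (punchInᵢ≢i y x ∘ sym)) ⟩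
  f y + sum {n} (λ _ → 0ℚ)   ≡⟨ cong (f y +_) (sum-replicate-zero n) ⟩
  f y + 0ℚ                   ≡⟨ +-identityʳ (f y) ⟩
  f y                        ∎
  where open ≡-Reasoning

when : ∀ {a} {A : Set a} → Dec A → ℚ → ℚ
when (yes _) q = q
when (no _)  _ = 0ℚ

module _ {a} {A : Set a} where

  when-yes : A → (d : Dec A) → ∀ q → when d q ≡ q
  when-yes _ (yes _) q = refl
  when-yes a (no ¬a) q = contradiction a ¬a

  when-no : ¬ A → (d : Dec A) → ∀ q → when d q ≡ 0ℚ
  when-no ¬a (yes a) q = contradiction a ¬a
  when-no _  (no _)  q = refl

  when-0 : (d : Dec A) → when d 0ℚ ≡ 0ℚ
  when-0 (yes _) = refl
  when-0 (no _)  = refl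

  when-+ : (d : Dec A) → ∀ q r → when d (q + r) ≡ when d q + when d r
  when-+ (yes _) q r = refl
  when-+ (no _)  q r = sym (+-identityˡ 0ℚ)

  when-nonNeg : (d : Dec A) → ∀ {q} → 0ℚ ≤ q → 0ℚ ≤ when d q
  when-nonNeg (yes _) q≥0 = q≥0
  when-nonNeg (no _)  _   = ≤-refl

  when-≤ : (d : Dec A) → ∀ {q r} → (A → q ≤ r) → 0ℚ ≤ r → when d q ≤ r
  when-≤ (yes a) q≤r _   = q≤r a
  when-≤ (no _)  _   r≥0 = r≥0

module _ {ℓ k : ℕ} (w : Tuple ℓ k → ℚ) where

  wᵢ-∷ : ∀ t G i x → wᵢ w (t ∷ G) i x ≡ when (lookup t i ≟ᶠ x) (w t) + wᵢ w G i x
  wᵢ-∷ t G i x with lookup t i ≟ᶠ x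
  ... | yes _ = refl
  ... | no  _ = sym (+-identityˡ _)

  wH-restricted≡sum-wᵢ : ∀ {p} {P : Pred (Fin ℓ) p} (P? : Decidable P) G i →
    wH (λ t → when (P? (lookup t i)) (w t)) G ≡ sum (λ x → when (P? x) (wᵢ w G i x))
  wH-restricted≡sum-wᵢ P? [] i =
    sym (trans (sum-cong-≗ (when-0 ∘ P?)) (sum-replicate-zero ℓ))
  wH-restricted≡sum-wᵢ P? (t ∷ G) i = begin
    when (P? y) (w t) + wH (λ t → when (P? (lookup t i)) (w t)) G
      ≡⟨ cong₂ _+_ (sym point-mass) (wH-restricted≡sum-wᵢ P? G i) ⟩
    sum from-t + sum from-G
      ≡⟨ ∑-distrib-+ from-t from-G ⟨
    sum (λ x → from-t x + from-G x)
      ≡⟨ sum-cong-≗ (λ x → trans (cong (when (P? x)) (wᵢ-∷ t G i x)) (when-+ (P? x) _ _)) ⟨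
    sum (λ x → when (P? x) (wᵢ w (t ∷ G) i x))
      ∎
    where
    open ≡-Reasoning
    y : Fin ℓ
    y = lookup t i
    from-t from-G : Fin ℓ → ℚ
    from-t x = when (P? x) (when (y ≟ᶠ x) (w t))
    from-G x = when (P? x) (wᵢ w G i x)
    point-mass : sum from-t ≡ when (P? y) (w t)
    point-mass = trans
      (sum-vanishing-off from-t y λ x y≢x → trans (cong (when (P? x)) (when-no y≢x (y ≟ᶠ x) (w t))) (when-0 (P? x)))
      (cong (when (P? y)) (when-yes refl (y ≟ᶠ y) (w t)))

  wH≤sum-wH-restricted : ∀ {q} {Q : Fin k → Pred (Fin ℓ) q} (Q? : ∀ i → Decidable (Q i)) {G} →
    All (λ t → 0ℚ ≤ w t) G → All (λ t → ∃ λ i → Q i (lookup t i)) G →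
    wH w G ≤ sum (λ i → wH (λ t → when (Q? i (lookup t i)) (w t)) G)
  wH≤sum-wH-restricted Q? [] [] = ≤-reflexive (sym (sum-replicate-zero k))
  wH≤sum-wH-restricted Q? {t ∷ G} (wt≥0 ∷ w≥0) ((i , Qᵢtᵢ) ∷ covered) = begin
    w t + wH w G
      ≤⟨ +-mono-≤ wt≤ (wH≤sum-wH-restricted Q? w≥0 covered) ⟩
    sum (restricted t) + sum (λ i → wH (λ t → restricted t i) G)
      ≡⟨ ∑-distrib-+ (restricted t) (λ i → wH (λ t → restricted t i) G) ⟨
    sum (λ i → wH (λ t → restricted t i) (t ∷ G))
      ∎
    where
    open ≤-Reasoning
    restricted : Tuple ℓ k → Fin k → ℚ
    restricted t i = when (Q? i (lookup t i)) (w t)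
    wt≤ : w t ≤ sum (restricted t)
    wt≤ = begin
      w t               ≡⟨ when-yes Qᵢtᵢ (Q? i (lookup t i)) (w t) ⟨
      restricted t i    ≤⟨ lookup≤sum (λ j → when-nonNeg (Q? j (lookup t j)) wt≥0) i ⟩
      sum (restricted t) ∎

  all-light⇒wH< : ∀ {H c t₀} → 0ℚ ≤ c → All (λ t → 0ℚ ≤ w t) H → t₀ ∈ H →
    All (λ t → ∃ λ i → wᵢ w H i (lookup t i) < c) H →
    wH w H < ℕtoℚ k * (ℕtoℚ ℓ * c)
  all-light⇒wH< {H} {c} {t₀} c≥0 w≥0 t₀∈H light = begin-strict
    wH w H
      ≤⟨ wH≤sum-wH-restricted light? w≥0 light ⟩
    sum (λ i → wH (λ t → when (light? i (lookup t i)) (w t)) H)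
      ≡⟨ sum-cong-≗ (λ i → wH-restricted≡sum-wᵢ (light? i) H i) ⟩
    sum (λ i → sum (λ x → when (light? i x) (wᵢ w H i x)))
      <⟨ sum-mono-< (λ i → sum-mono-≤ (term≤c i)) i₀ (sum-mono-< (term≤c i₀) x₀ term₀<c) ⟩
    sum {k} (λ _ → sum {ℓ} (λ _ → c))
      ≡⟨ sum-const k (sum {ℓ} (λ _ → c)) ⟩
    ℕtoℚ k * sum {ℓ} (λ _ → c)
      ≡⟨ cong (ℕtoℚ k *_) (sum-const ℓ c) ⟩
    ℕtoℚ k * (ℕtoℚ ℓ * c)
      ∎
    where
    open ≤-Reasoning
    light? : ∀ i → Decidable (λ x → wᵢ w H i x < c)
    light? i x = wᵢ w H i x <? c
    term≤c : ∀ i x → when (light? i x) (wᵢ w H i x) ≤ c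
    term≤c i x = when-≤ (light? i x) <⇒≤ c≥0
    i₀ : Fin k
    i₀ = proj₁ (All.lookup light t₀∈H)
    x₀ : Fin ℓ
    x₀ = lookup t₀ i₀
    term₀<c : when (light? i₀ x₀) (wᵢ w H i₀ x₀) < c
    term₀<c = let lt = proj₂ (All.lookup light t₀∈H) in
      ≤-<-trans (≤-reflexive (when-yes lt (light? i₀ x₀) _)) lt

  wH-pos⇒nonEmpty : ∀ H → 0ℚ < wH w H → ∃ λ t → t ∈ H
  wH-pos⇒nonEmpty []      0<0 = contradiction 0<0 (<-irrefl refl)
  wH-pos⇒nonEmpty (t ∷ _) _   = t , here refl

  Heavy : List (Tuple ℓ k) → ℚ → Tuple ℓ k → Set
  Heavy H c t = (i : Fin k) → c ≤ wᵢ w H i (lookup t i)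

  heavy? : ∀ H c → Decidable (Heavy H c)
  heavy? H c t = all? (λ i → c ≤? wᵢ w H i (lookup t i))

  ¬heavy⇒light : ∀ H c {t} → ¬ Heavy H c t → ∃ λ i → wᵢ w H i (lookup t i) < c
  ¬heavy⇒light H c {t} not-heavy =
    let i , c≰wᵢ = ¬∀⟶∃¬ k _ (λ i → c ≤? wᵢ w H i (lookup t i)) not-heavy in i , ≰⇒> c≰wᵢ

  heavy-tuple-exists : ∀ H c → 0ℚ ≤ c → All (λ t → 0ℚ ≤ w t) H →
    0ℚ < wH w H → ℕtoℚ k * (ℕtoℚ ℓ * c) ≤ wH w H → Σ (Tuple ℓ k) (λ t → t ∈ H × Heavy H c t)
  heavy-tuple-exists H c c≥0 w≥0 wH>0 kℓc≤wH with any? (heavy? H c) H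
  ... | yes some-heavy = find some-heavy
  ... | no  none-heavy = contradiction (<-≤-trans wH<kℓc kℓc≤wH) (<-irrefl refl)
    where
    wH<kℓc : wH w H < ℕtoℚ k * (ℕtoℚ ℓ * c)
    wH<kℓc = all-light⇒wH< c≥0 w≥0 (proj₂ (wH-pos⇒nonEmpty H wH>0))
               (All.map (λ {t} → ¬heavy⇒light H c {t}) (¬Any⇒All¬ H none-heavy))

module _ (a : ℚ) .{{_ : Positive a}} where

  private instance
    a²>0 : Positive (a * a)
    a²>0 = pos*pos⇒pos a a
    a²≢0 : NonZeroℚ (a * a)
    a²≢0 = pos⇒nonZero (a * a)

  /sq-nonNeg : ∀ p .{{_ : NonNegative p}} → NonNegative (p /sq a)
  /sq-nonNeg p = nonNeg*nonNeg⇒nonNeg p (1/ (a * a)) {{pos⇒nonNeg (1/ (a * a)) {{1/pos⇒pos (a * a)}}}}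

  *-/sq≤ : ∀ q p .{{_ : NonNegative p}} → q ≤ a * a → q * (p /sq a) ≤ p
  *-/sq≤ q p q≤a² = begin
    q * (p * 1/ (a * a))          ≤⟨ *-monoʳ-≤-nonNeg (p /sq a) {{/sq-nonNeg p}} q≤a² ⟩
    a * a * (p * 1/ (a * a))      ≡⟨ x∙yz≈y∙xz (a * a) p (1/ (a * a)) ⟩
    p * (a * a * 1/ (a * a))      ≡⟨ cong (p *_) (*-inverseʳ (a * a)) ⟩
    p * 1ℚ                        ≡⟨ *-identityʳ p ⟩
    p                             ∎
    where open ≤-Reasoning

claim5p3 : (ℓ k : ℕ) → .{{_ : NonZero ℓ}}
    → (H : List (Tuple ℓ k)) → Unique H
    → (w : Tuple ℓ k → ℚ) → (∀ t → t ∈ H → NonNegative (w t))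
    → (p : ℚ) → .{{_ : Positive p}}
    → p * ℕtoℚ ℓ ≤ wH w H
    → (a : ℚ) → .{{pa : Positive a}} → ℕtoℚ k ≤ a * a
    → Σ (Tuple ℓ k) (λ t → t ∈ H × ((i : Fin k) → (p /sq a) {{pa}} ≤ wᵢ w H i (lookup t i)))
claim5p3 ℓ k H _ w w≥0 p pℓ≤wH a k≤a² =
  heavy-tuple-exists w H c c≥0 w≥0′ (<-≤-trans pℓ>0 pℓ≤wH) kℓc≤wH
  where
  open ≤-Reasoning
  instance
    p≥0 : NonNegative p
    p≥0 = pos⇒nonNeg p
  c : ℚ
  c = p /sq a
  c≥0 : 0ℚ ≤ c
  c≥0 = nonNegative⁻¹ c {{/sq-nonNeg a p}}
  w≥0′ : All (λ t → 0ℚ ≤ w t) H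
  w≥0′ = All.tabulate λ {t} t∈H → nonNegative⁻¹ (w t) {{w≥0 t t∈H}}
  pℓ>0 : 0ℚ < p * ℕtoℚ ℓ
  pℓ>0 = positive⁻¹ _ {{pos*pos⇒pos p (ℕtoℚ ℓ) {{normalize-pos ℓ 1}}}}
  kℓc≤wH : ℕtoℚ k * (ℕtoℚ ℓ * c) ≤ wH w H
  kℓc≤wH = begin
    ℕtoℚ k * (ℕtoℚ ℓ * c)  ≡⟨ x∙yz≈y∙xz (ℕtoℚ k) (ℕtoℚ ℓ) c ⟩
    ℕtoℚ ℓ * (ℕtoℚ k * c)  ≤⟨ *-monoˡ-≤-nonNeg (ℕtoℚ ℓ) {{normalize-nonNeg ℓ 1}} (*-/sq≤ a (ℕtoℚ k) p k≤a²) ⟩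
    ℕtoℚ ℓ * p             ≡⟨ *-comm (ℕtoℚ ℓ) p ⟩
    p * ℕtoℚ ℓ             ≤⟨ pℓ≤wH ⟩
    wH w H                 ∎
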